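{- Let $k\geq 2$ be an integer and let $D$ be a $\mathrm{DD}(m)$. Then $C_k(D)=km(m-1)$ if and only if $D$ is equivalent to a perfect Golomb ruler.
   Context: A $\mathrm{DD}(m)$ is a set $D=\{\mathbf{v}_1,\dots,\mathbf{v}_m\}$ of $m$ points of $\mathbb{Z}^2$ whose difference vectors $\mathbf{v}_i-\mathbf{v}_j$ ($i\ne j$) are all distinct. The $k$-hop coverage $C_k(D)$ is the number of non-zero vectors expressible as a sum of at most $k$ difference vectors of $D$ (always $C_k(D)\ge km(m-1)$). A Golomb ruler is a set $M$ of $m$ integers such that the differences $x-y$ with $x,y\in M$, $x\ne y$, are all distinct; it is perfect if $\{u-v:u,v\in M\}=\{i\in\mathbb{Z}:|i|\le m(m-1)/2\}$. $D$ is equivalent to a perfect Golomb ruler if $D=\{\mathbf{r}+i\mathbf{s}: i\in M\}$ for some vectors $\mathbf{r},\mathbf{s}\in\mathbb{Z}^2$ and some perfect Golomb ruler $M$. -}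

module Defs where

open import Data.Nat as ℕ using (ℕ; zero; suc)
open import Data.Integer as ℤ using (ℤ)
open import Data.Integer.Properties as ℤP using ()
open import Data.Fin as Fin using (Fin)
open import Data.Fin.Properties as FinP using ()
open import Data.Product using (_×_; _,_; Σ; ∃)
open import Data.Product.Properties using (≡-dec)
open import Data.List using (List; []; _∷_; [_]; _++_; concatMap; allFin; filter; deduplicate; length; map)
open import Relation.Binary.PropositionalEquality using (_≡_; _≢_)
open import Relation.Nullary using (¬?; yes; no)
open import Relation.Binary using (DecidableEquality)
open import Function.Bundles using (_⇔_)

Point : Set
Point = ℤ × ℤ

_≟P_ : DecidableEquality Point
_≟P_ = ≡-dec ℤ._≟_ ℤ._≟_

origin : Point
origin = (ℤ.0ℤ , ℤ.0ℤ)

_⊕_ : Point → Point → Point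
(a , b) ⊕ (c , d) = (a ℤ.+ c , b ℤ.+ d)

_⊖_ : Point → Point → Point
(a , b) ⊖ (c , d) = (a ℤ.- c , b ℤ.- d)

_·_ : ℤ → Point → Point
i · (a , b) = (i ℤ.* a , i ℤ.* b)

IsDD : ∀ {m} → (Fin m → Point) → Set
IsDD {m} D = ∀ (i j k l : Fin m) → i ≢ j → k ≢ l →
  D i ⊖ D j ≡ D k ⊖ D l → (i ≡ k × j ≡ l)

diffs : ∀ {m} → (Fin m → Point) → List Point
diffs {m} D = concatMap (λ i → concatMap (λ j → pick i j) (allFin m)) (allFin m)
  where
  pick : Fin m → Fin m → List Point
  pick i j with i Fin.≟ j
  ... | yes _ = []
  ... | no _ = [ D i ⊖ D j ]

sumsUpTo : List Point → ℕ → List Point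
sumsUpTo ds zero = [ origin ]
sumsUpTo ds (suc k) =
  sumsUpTo ds k ++ concatMap (λ s → map (λ d → s ⊕ d) ds) (sumsUpTo ds k)

coverage : ℕ → ∀ {m} → (Fin m → Point) → ℕ
coverage k D =
  length (deduplicate _≟P_ (filter (λ p → ¬? (p ≟P origin)) (sumsUpTo (diffs D) k)))

IsGolomb : ∀ {n} → (Fin n → ℤ) → Set
IsGolomb {n} M = ∀ (i j k l : Fin n) → i ≢ j → k ≢ l →
  M i ℤ.- M j ≡ M k ℤ.- M l → (i ≡ k × j ≡ l)

IsPerfect : ∀ {n} → (Fin n → ℤ) → Set
IsPerfect {n} M = ∀ (z : ℤ) →
  (∃ λ (u : Fin n) → ∃ λ (v : Fin n) → M u ℤ.- M v ≡ z) ⇔ (ℤ.∣ z ∣ ℕ.≤ (n ℕ.* (n ℕ.∸ 1)) ℕ./ 2)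

EquivPerfectGolomb : ∀ {m} → (Fin m → Point) → Set
EquivPerfectGolomb {m} D =
  Σ ℕ λ n → Σ (Fin n → ℤ) λ M → IsGolomb M × IsPerfect M ×
  Σ Point λ r → Σ Point λ s →
    ∀ (p : Point) → (∃ λ (i : Fin m) → D i ≡ p) ⇔ (∃ λ (j : Fin n) → r ⊕ (M j · s) ≡ p)

module Submission where

-- Let S be the list of the m(m − 1) difference vectors of D. If D = r + M·s for a perfect ruler M,
-- then S = {c·s : 0 < ∣c∣ ≤ T} with T = m(m − 1)/2, the nonzero sums of at most k elements of S are
-- exactly the c·s with 0 < ∣c∣ ≤ kT, and so C_k(D) = 2kT = k·m(m − 1).
-- Conversely, order ℤ² lexicographically and let P be the positive half of S, with least element p₁
-- and greatest element a. The vectors ±(j·a + p), j < k, p ∈ P, are k·∣S∣ distinct nonzero sums of at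
-- most k differences, so when C_k(D) = k·m(m − 1) there are no others. For p ∈ P other than p₁ the
-- 2-sum p − p₁ is positive and below a, hence of the form 0·a + p′, i.e. p − p₁ ∈ P. Descending, P
-- consists of p₁, 2p₁, …, T·p₁, which says that D = D₀ + M·p₁ for a perfect ruler M.

open import Defs
open import Data.Nat using (ℕ; _≤_; _*_; _∸_)
open import Data.Fin using (Fin)
open import Relation.Binary.PropositionalEquality using (_≡_)
open import Function.Bundles using (_⇔_)

open import Data.Nat as ℕ using (zero; suc; _+_; _<_; z≤n; s≤s)
import Data.Nat.Properties as ℕ
import Data.Nat.Induction as ℕ
open import Data.Nat.DivMod using (m*n/n≡m)
open import Data.Integer as ℤ using (ℤ; +_; -[1+_]; 0ℤ)
import Data.Integer.Properties as ℤ
open import Data.Integer.Tactic.RingSolver using (solve-∀)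
open import Data.Fin as Fin using (punchIn; punchOut)
open import Data.Fin.Properties using (punchInᵢ≢i; punchIn-punchOut; punchIn-injective)
open import Data.Product using (_×_; _,_; ∃; proj₁; proj₂)
open import Data.Sum using (_⊎_; inj₁; inj₂; [_,_])
open import Data.Empty using (⊥; ⊥-elim)
open import Data.List as List
  using (List; []; _∷_; _++_; map; length; filter; deduplicate; allFin; upTo; cartesianProductWith)
import Data.List.Properties as List
open import Data.List.Membership.Propositional using (_∈_; _∉_; find)
open import Data.List.Membership.Propositional.Properties
open import Data.List.Relation.Binary.Subset.Propositional using (_⊆_)
open import Data.List.Relation.Unary.Any as Any using (here; there; _─_)
import Data.List.Relation.Unary.All as All
open import Data.List.Relation.Unary.All.Properties using (¬Any⇒All¬; map⁺; map⁻; concat⁻)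
open import Data.List.Relation.Unary.AllPairs using ([]; _∷_)
open import Data.List.Relation.Unary.Unique.Propositional using (Unique)
import Data.List.Relation.Unary.Unique.Propositional.Properties as Unique
open import Data.List.Relation.Unary.Unique.DecPropositional.Properties _≟P_ using (deduplicate-!)
open import Function using (id; _∘_; flip; _on_; case_of_)
open import Function.Bundles using (Equivalence; mk⇔)
open import Induction.WellFounded using (Acc; acc)
open import Level using (0ℓ)
open import Relation.Binary using (Rel; DecidableEquality; Transitive; Total; tri<; tri≈; tri>)
import Relation.Binary.Construct.On as On
open import Relation.Binary.PropositionalEquality using (_≢_; refl; sym; trans; cong; cong₂; subst; module ≡-Reasoning)
open import Relation.Nullary using (¬_; ¬?; yes; no)
open import Relation.Unary using (Decidable)

open Equivalence using (to; from)

module _ {A : Set} where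

  ∈-─⁺ : ∀ {x y} {ys : List A} (x∈ys : x ∈ ys) → y ∈ ys → y ≢ x → y ∈ (ys ─ x∈ys)
  ∈-─⁺ (here refl) (here refl) y≢x = ⊥-elim (y≢x refl)
  ∈-─⁺ (here refl) (there y∈ys) _ = y∈ys
  ∈-─⁺ (there _) (here refl) _ = here refl
  ∈-─⁺ (there x∈ys) (there y∈ys) y≢x = there (∈-─⁺ x∈ys y∈ys y≢x)

  unique-⊆⇒length≤ : ∀ {xs ys : List A} → Unique xs → xs ⊆ ys → length xs ≤ length ys
  unique-⊆⇒length≤ [] _ = z≤n
  unique-⊆⇒length≤ {x ∷ xs} {ys} (x∉xs ∷ u) x∷xs⊆ys =
    subst (suc (length xs) ≤_) (sym (List.length-removeAt′ ys (Any.index x∈ys)))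
      (s≤s (unique-⊆⇒length≤ u λ z∈xs →
        ∈-─⁺ x∈ys (x∷xs⊆ys (there z∈xs)) (λ { refl → All.lookup x∉xs z∈xs refl })))
    where
    x∈ys : x ∈ ys
    x∈ys = x∷xs⊆ys (here refl)

  unique-⊆-⊇⇒length≡ : ∀ {xs ys : List A} → Unique xs → Unique ys → xs ⊆ ys → ys ⊆ xs → length xs ≡ length ys
  unique-⊆-⊇⇒length≡ uxs uys xs⊆ys ys⊆xs =
    ℕ.≤-antisym (unique-⊆⇒length≤ uxs xs⊆ys) (unique-⊆⇒length≤ uys ys⊆xs)

  unique-⊆-length≥⇒⊇ : DecidableEquality A → ∀ {xs ys : List A} →
                       Unique xs → xs ⊆ ys → length ys ≤ length xs → ys ⊆ xs
  unique-⊆-length≥⇒⊇ _≟_ {xs} {ys} uxs xs⊆ys |ys|≤|xs| {z} z∈ys with Any.any? (z ≟_) xs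
  ... | yes z∈xs = z∈xs
  ... | no z∉xs =
    ⊥-elim (ℕ.<-irrefl refl (ℕ.≤-trans (unique-⊆⇒length≤ (¬Any⇒All¬ xs z∉xs ∷ uxs) z∷xs⊆ys) |ys|≤|xs|))
    where
    z∷xs⊆ys : z ∷ xs ⊆ ys
    z∷xs⊆ys (here refl) = z∈ys
    z∷xs⊆ys (there w∈xs) = xs⊆ys w∈xs

module _ {A B : Set} where

  map-unique : ∀ (f : A → B) {xs} → (∀ {x y} → x ∈ xs → y ∈ xs → f x ≡ f y → x ≡ y) →
               Unique xs → Unique (map f xs)
  map-unique f _ [] = []
  map-unique f {x ∷ xs} inj (x∉xs ∷ u) =
    map⁺ (All.tabulate (λ y∈xs fx≡fy → All.lookup x∉xs y∈xs (inj (here refl) (there y∈xs) fx≡fy)))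
      ∷ map-unique f (λ x∈xs y∈xs → inj (there x∈xs) (there y∈xs)) u

module _ {A B C : Set} (f : A → B → C) where

  length-cartesianProductWith : ∀ (xs : List A) (ys : List B) →
    length (cartesianProductWith f xs ys) ≡ length xs * length ys
  length-cartesianProductWith [] ys = refl
  length-cartesianProductWith (x ∷ xs) ys = begin
    length (map (f x) ys ++ cartesianProductWith f xs ys)  ≡⟨ List.length-++ (map (f x) ys) ⟩
    length (map (f x) ys) + length (cartesianProductWith f xs ys)
      ≡⟨ cong₂ _+_ (List.length-map (f x) ys) (length-cartesianProductWith xs ys) ⟩
    length ys + length xs * length ys  ∎
    where open ≡-Reasoning

  cartesianProductWith-unique : ∀ {xs ys} →
    (∀ {x x′ y y′} → x ∈ xs → x′ ∈ xs → y ∈ ys → y′ ∈ ys →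
                     f x y ≡ f x′ y′ → x ≡ x′ × y ≡ y′) →
    Unique xs → Unique ys → Unique (cartesianProductWith f xs ys)
  cartesianProductWith-unique _ [] _ = []
  cartesianProductWith-unique {x ∷ xs} {ys} inj (x∉xs ∷ uxs) uys =
    Unique.++⁺ (map-unique (f x) (λ y∈ y′∈ e → proj₂ (inj (here refl) (here refl) y∈ y′∈ e)) uys)
               (cartesianProductWith-unique (λ x∈ x′∈ → inj (there x∈) (there x′∈)) uxs uys)
               disjoint
    where
    disjoint : ∀ {v} → ¬ (v ∈ map (f x) ys × v ∈ cartesianProductWith f xs ys)
    disjoint (v∈row , v∈rest) with ∈-map⁻ (f x) v∈row | ∈-cartesianProductWith⁻ f xs ys v∈rest
    ... | y , y∈ , refl | x′ , y′ , x′∈ , y′∈ , e =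
      All.lookup x∉xs x′∈ (proj₁ (inj (here refl) (there x′∈) y∈ y′∈ e))

module _ {A : Set} {_≤_ : Rel A 0ℓ} (total : Total _≤_) (trans : Transitive _≤_) where

  ∃-greatest : ∀ {x} {xs : List A} → x ∈ xs → ∃ λ g → g ∈ xs × (∀ {y} → y ∈ xs → y ≤ g)
  ∃-greatest {xs = x ∷ xs} _ = greatest x xs
    where
    reflexive : ∀ y → y ≤ y
    reflexive y = [ id , id ] (total y y)

    greatest : ∀ x xs → ∃ λ g → g ∈ x ∷ xs × (∀ {y} → y ∈ x ∷ xs → y ≤ g)
    greatest x [] = x , here refl , λ { (here refl) → reflexive x }
    greatest x (x′ ∷ xs) with greatest x′ xs
    ... | g , g∈ , ≤g with total x g
    ...   | inj₁ x≤g = g , there g∈ , λ { (here refl) → x≤g ; (there y∈) → ≤g y∈ }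
    ...   | inj₂ g≤x = x , here refl , λ { (here refl) → reflexive x ; (there y∈) → trans (≤g y∈) g≤x }

neg : Point → Point
neg (a , b) = (ℤ.- a , ℤ.- b)

⊕-identityˡ : ∀ p → origin ⊕ p ≡ p
⊕-identityˡ (a , b) = cong₂ _,_ (ℤ.+-identityˡ a) (ℤ.+-identityˡ b)

⊕-identityʳ : ∀ p → p ⊕ origin ≡ p
⊕-identityʳ (a , b) = cong₂ _,_ (ℤ.+-identityʳ a) (ℤ.+-identityʳ b)

p⊖p≡origin : ∀ p → p ⊖ p ≡ origin
p⊖p≡origin (a , b) = cong₂ _,_ (ℤ.+-inverseʳ a) (ℤ.+-inverseʳ b)

p⊖q≡origin⇒p≡q : ∀ p q → p ⊖ q ≡ origin → p ≡ q
p⊖q≡origin⇒p≡q (a , b) (c , d) e = cong₂ _,_ (ℤ.i-j≡0⇒i≡j a c (cong proj₁ e)) (ℤ.i-j≡0⇒i≡j b d (cong proj₂ e))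

neg-involutive : ∀ p → neg (neg p) ≡ p
neg-involutive (a , b) = cong₂ _,_ (ℤ.neg-involutive a) (ℤ.neg-involutive b)

neg-injective : ∀ {p q} → neg p ≡ neg q → p ≡ q
neg-injective {p} {q} e = trans (sym (neg-involutive p)) (trans (cong neg e) (neg-involutive q))

neg[p⊖q]≡q⊖p : ∀ p q → neg (p ⊖ q) ≡ q ⊖ p
neg[p⊖q]≡q⊖p (a , b) (c , d) = cong₂ _,_ (lemma a c) (lemma b d)
  where
  lemma : ∀ x y → ℤ.- (x ℤ.- y) ≡ y ℤ.- x
  lemma = solve-∀

[p⊖q]⊕[q⊖r]≡p⊖r : ∀ p q r → (p ⊖ q) ⊕ (q ⊖ r) ≡ p ⊖ r
[p⊖q]⊕[q⊖r]≡p⊖r (a , b) (c , d) (e , f) = cong₂ _,_ (lemma a c e) (lemma b d f)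
  where
  lemma : ∀ x y z → (x ℤ.- y) ℤ.+ (y ℤ.- z) ≡ x ℤ.- z
  lemma = solve-∀

[p⊕q]⊖p≡q : ∀ p q → (p ⊕ q) ⊖ p ≡ q
[p⊕q]⊖p≡q (a , b) (c , d) = cong₂ _,_ (lemma a c) (lemma b d)
  where
  lemma : ∀ x y → (x ℤ.+ y) ℤ.- x ≡ y
  lemma = solve-∀

[p⊕q]⊖q≡p : ∀ p q → (p ⊕ q) ⊖ q ≡ p
[p⊕q]⊖q≡p (a , b) (c , d) = cong₂ _,_ (lemma a c) (lemma b d)
  where
  lemma : ∀ x y → (x ℤ.+ y) ℤ.- y ≡ x
  lemma = solve-∀

[p⊖q]⊕q≡p : ∀ p q → (p ⊖ q) ⊕ q ≡ p
[p⊖q]⊕q≡p (a , b) (c , d) = cong₂ _,_ (lemma a c) (lemma b d)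
  where
  lemma : ∀ x y → (x ℤ.- y) ℤ.+ y ≡ x
  lemma = solve-∀

p⊕[q⊖p]≡q : ∀ p q → p ⊕ (q ⊖ p) ≡ q
p⊕[q⊖p]≡q (a , b) (c , d) = cong₂ _,_ (lemma a c) (lemma b d)
  where
  lemma : ∀ x y → x ℤ.+ (y ℤ.- x) ≡ y
  lemma = solve-∀

p⊖[p⊖q]≡q : ∀ p q → p ⊖ (p ⊖ q) ≡ q
p⊖[p⊖q]≡q (a , b) (c , d) = cong₂ _,_ (lemma a c) (lemma b d)
  where
  lemma : ∀ x y → x ℤ.- (x ℤ.- y) ≡ y
  lemma = solve-∀

·-identityˡ : ∀ p → (+ 1) · p ≡ p
·-identityˡ (a , b) = cong₂ _,_ (ℤ.*-identityˡ a) (ℤ.*-identityˡ b)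

·-zeroʳ : ∀ A → A · origin ≡ origin
·-zeroʳ A = cong₂ _,_ (ℤ.*-zeroʳ A) (ℤ.*-zeroʳ A)

neg-· : ∀ A p → neg (A · p) ≡ (ℤ.- A) · p
neg-· A (a , b) = cong₂ _,_ (ℤ.neg-distribˡ-* A a) (ℤ.neg-distribˡ-* A b)

·-neg : ∀ A p → A · neg p ≡ (ℤ.- A) · p
·-neg A (a , b) = cong₂ _,_ (lemma A a) (lemma A b)
  where
  lemma : ∀ A x → A ℤ.* (ℤ.- x) ≡ (ℤ.- A) ℤ.* x
  lemma = solve-∀

·-distribʳ-+ : ∀ A B p → (A · p) ⊕ (B · p) ≡ (A ℤ.+ B) · p
·-distribʳ-+ A B (a , b) = cong₂ _,_ (lemma A B a) (lemma A B b)
  where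
  lemma : ∀ A B x → A ℤ.* x ℤ.+ B ℤ.* x ≡ (A ℤ.+ B) ℤ.* x
  lemma = solve-∀

·-suc : ∀ j p → (+ suc j) · p ≡ ((+ j) · p) ⊕ p
·-suc j (a , b) = cong₂ _,_ (lemma (+ j) a) (lemma (+ j) b)
  where
  lemma : ∀ J x → (ℤ.1ℤ ℤ.+ J) ℤ.* x ≡ J ℤ.* x ℤ.+ x
  lemma = solve-∀

·-suc-⊕ : ∀ j p q → ((+ suc j) · p) ⊕ q ≡ (((+ j) · p) ⊕ q) ⊕ p
·-suc-⊕ j (a , b) (c , d) = cong₂ _,_ (lemma (+ j) a c) (lemma (+ j) b d)
  where
  lemma : ∀ J x y → (ℤ.1ℤ ℤ.+ J) ℤ.* x ℤ.+ y ≡ (J ℤ.* x ℤ.+ y) ℤ.+ x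
  lemma = solve-∀

neg-·-⊕ : ∀ A p q → neg ((A · p) ⊕ q) ≡ (A · neg p) ⊕ neg q
neg-·-⊕ A (a , b) (c , d) = cong₂ _,_ (lemma A a c) (lemma A b d)
  where
  lemma : ∀ A x y → ℤ.- (A ℤ.* x ℤ.+ y) ≡ A ℤ.* (ℤ.- x) ℤ.+ ℤ.- y
  lemma = solve-∀

affine-⊖ : ∀ r A B p → (r ⊕ (A · p)) ⊖ (r ⊕ (B · p)) ≡ (A ℤ.- B) · p
affine-⊖ (r₁ , r₂) A B (a , b) = cong₂ _,_ (lemma r₁ A B a) (lemma r₂ A B b)
  where
  lemma : ∀ r A B x → (r ℤ.+ A ℤ.* x) ℤ.- (r ℤ.+ B ℤ.* x) ≡ (A ℤ.- B) ℤ.* x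
  lemma = solve-∀

·-cancelʳ : ∀ {p} → p ≢ origin → ∀ A B → A · p ≡ B · p → A ≡ B
·-cancelʳ {a , b} p≢0 A B Ap≡Bp with a ℤ.≟ 0ℤ | b ℤ.≟ 0ℤ
... | no a≢0 | _ = ℤ.*-cancelʳ-≡ A B a {{ℤ.≢-nonZero a≢0}} (cong proj₁ Ap≡Bp)
... | yes _ | no b≢0 = ℤ.*-cancelʳ-≡ A B b {{ℤ.≢-nonZero b≢0}} (cong proj₂ Ap≡Bp)
... | yes refl | yes refl = ⊥-elim (p≢0 refl)

·-≢origin : ∀ {p} → p ≢ origin → ∀ {A} → A ≢ 0ℤ → A · p ≢ origin
·-≢origin p≢0 A≢0 Ap≡0 = A≢0 (·-cancelʳ p≢0 _ 0ℤ Ap≡0)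

-- The lexicographic order on ℤ²

Positive : Point → Set
Positive (a , b) = 0ℤ ℤ.< a ⊎ (a ≡ 0ℤ × 0ℤ ℤ.< b)

NonNegative : Point → Set
NonNegative p = Positive p ⊎ p ≡ origin

_≼_ : Point → Point → Set
p ≼ q = NonNegative (q ⊖ p)

Positive-⊕ : ∀ {p q} → Positive p → Positive q → Positive (p ⊕ q)
Positive-⊕ (inj₁ 0<a) (inj₁ 0<c) = inj₁ (ℤ.+-mono-< 0<a 0<c)
Positive-⊕ {a , _} (inj₁ 0<a) (inj₂ (refl , _)) = inj₁ (subst (0ℤ ℤ.<_) (sym (ℤ.+-identityʳ a)) 0<a)
Positive-⊕ {q = c , _} (inj₂ (refl , _)) (inj₁ 0<c) = inj₁ (subst (0ℤ ℤ.<_) (sym (ℤ.+-identityˡ c)) 0<c)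
Positive-⊕ (inj₂ (refl , 0<b)) (inj₂ (refl , 0<d)) = inj₂ (refl , ℤ.+-mono-< 0<b 0<d)

NonNegative-⊕-Positive : ∀ {p q} → NonNegative p → Positive q → Positive (p ⊕ q)
NonNegative-⊕-Positive (inj₁ p>0) q>0 = Positive-⊕ p>0 q>0
NonNegative-⊕-Positive {q = q} (inj₂ refl) q>0 = subst Positive (sym (⊕-identityˡ q)) q>0

NonNegative-⊕ : ∀ {p q} → NonNegative p → NonNegative q → NonNegative (p ⊕ q)
NonNegative-⊕ p≥0 (inj₁ q>0) = inj₁ (NonNegative-⊕-Positive p≥0 q>0)
NonNegative-⊕ {p} p≥0 (inj₂ refl) = subst NonNegative (sym (⊕-identityʳ p)) p≥0

NonNegative∧≢origin⇒Positive : ∀ {p} → NonNegative p → p ≢ origin → Positive p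
NonNegative∧≢origin⇒Positive (inj₁ p>0) _ = p>0
NonNegative∧≢origin⇒Positive (inj₂ p≡0) p≢0 = ⊥-elim (p≢0 p≡0)

Positive⇒≢origin : ∀ {p} → Positive p → p ≢ origin
Positive⇒≢origin (inj₁ 0<0) refl = ℤ.<-irrefl refl 0<0
Positive⇒≢origin (inj₂ (_ , 0<0)) refl = ℤ.<-irrefl refl 0<0

Positive⇒¬Positive-neg : ∀ {p} → Positive p → ¬ Positive (neg p)
Positive⇒¬Positive-neg {p} p>0 -p>0 = Positive⇒≢origin (Positive-⊕ p>0 -p>0) (p⊖p≡origin p)

Positive-trichotomy : ∀ p → Positive p ⊎ p ≡ origin ⊎ Positive (neg p)
Positive-trichotomy (a , b) with ℤ.<-cmp 0ℤ a
... | tri< 0<a _ _ = inj₁ (inj₁ 0<a)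
... | tri> _ _ a<0 = inj₂ (inj₂ (inj₁ (ℤ.neg-mono-< a<0)))
... | tri≈ _ refl _ with ℤ.<-cmp 0ℤ b
...   | tri< 0<b _ _ = inj₁ (inj₂ (refl , 0<b))
...   | tri≈ _ refl _ = inj₂ (inj₁ refl)
...   | tri> _ _ b<0 = inj₂ (inj₂ (inj₂ (refl , ℤ.neg-mono-< b<0)))

opaque
  Positive? : Decidable Positive
  Positive? p with Positive-trichotomy p
  ... | inj₁ p>0 = yes p>0
  ... | inj₂ (inj₁ refl) = no (λ 0>0 → Positive⇒≢origin 0>0 refl)
  ... | inj₂ (inj₂ -p>0) = no (λ p>0 → Positive⇒¬Positive-neg p>0 -p>0)

NonNegative-· : ∀ {p} → Positive p → ∀ j → NonNegative ((+ j) · p)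
NonNegative-· p>0 zero = inj₂ refl
NonNegative-· {p} p>0 (suc j) = inj₁ (subst Positive (sym (·-suc j p)) (NonNegative-⊕-Positive (NonNegative-· p>0 j) p>0))

≼-trans : Transitive _≼_
≼-trans {p} {q} {r} p≼q q≼r = subst NonNegative ([p⊖q]⊕[q⊖r]≡p⊖r r q p) (NonNegative-⊕ q≼r p≼q)

≼-total : Total _≼_
≼-total p q with Positive-trichotomy (q ⊖ p)
... | inj₁ q>p = inj₁ (inj₁ q>p)
... | inj₂ (inj₁ q≡p) = inj₁ (inj₂ q≡p)
... | inj₂ (inj₂ p>q) = inj₂ (inj₁ (subst Positive (neg[p⊖q]≡q⊖p q p) p>q))

module _ (S : List Point) where

  origin∈sumsUpTo : ∀ k → origin ∈ sumsUpTo S k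
  origin∈sumsUpTo zero = here refl
  origin∈sumsUpTo (suc k) = ∈-++⁺ˡ (origin∈sumsUpTo k)

  sumsUpTo-mono : ∀ {k k′ x} → k ≤ k′ → x ∈ sumsUpTo S k → x ∈ sumsUpTo S k′
  sumsUpTo-mono k≤k′ = mono (ℕ.≤⇒≤′ k≤k′)
    where
    mono : ∀ {k k′ x} → k ℕ.≤′ k′ → x ∈ sumsUpTo S k → x ∈ sumsUpTo S k′
    mono ℕ.≤′-refl x∈ = x∈
    mono (ℕ.≤′-step k≤′k′) x∈ = ∈-++⁺ˡ (mono k≤′k′ x∈)

  sumsUpTo-⊕ : ∀ k {x d} → x ∈ sumsUpTo S k → d ∈ S → x ⊕ d ∈ sumsUpTo S (suc k)
  sumsUpTo-⊕ k {x} x∈ d∈S = ∈-++⁺ʳ (sumsUpTo S k)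
    (∈-concatMap⁺ (λ s → map (s ⊕_) S) (Any.map (λ { refl → ∈-map⁺ (x ⊕_) d∈S }) x∈))

  ∈⇒∈sumsUpTo : ∀ {k d} → d ∈ S → d ∈ sumsUpTo S (suc k)
  ∈⇒∈sumsUpTo {k} {d} d∈S =
    subst (_∈ sumsUpTo S (suc k)) (⊕-identityˡ d) (sumsUpTo-⊕ k (origin∈sumsUpTo k) d∈S)

  sumsUpTo-ind : (R : ℕ → Point → Set) → R 0 origin → (∀ {k x} → R k x → R (suc k) x) →
                 (∀ {k x d} → R k x → d ∈ S → R (suc k) (x ⊕ d)) →
                 ∀ k {x} → x ∈ sumsUpTo S k → R k x
  sumsUpTo-ind R base mono step zero (here refl) = base
  sumsUpTo-ind R base mono step (suc k) x∈ with ∈-++⁻ (sumsUpTo S k) x∈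
  ... | inj₁ x∈sums = mono (sumsUpTo-ind R base mono step k x∈sums)
  ... | inj₂ x∈sums⊕S with find (∈-concatMap⁻ (λ s → map (s ⊕_) S) {xs = sumsUpTo S k} x∈sums⊕S)
  ...   | s , s∈ , x∈s⊕S with ∈-map⁻ (s ⊕_) x∈s⊕S
  ...     | d , d∈S , refl = step (sumsUpTo-ind R base mono step k s∈) d∈S

  sumsUpTo-⊕-origin∷ : ∀ k {x d} → x ∈ sumsUpTo S k → d ∈ origin ∷ S → x ⊕ d ∈ sumsUpTo S (suc k)
  sumsUpTo-⊕-origin∷ k {x} x∈ (here refl) =
    subst (_∈ sumsUpTo S (suc k)) (sym (⊕-identityʳ x)) (sumsUpTo-mono (ℕ.n≤1+n k) x∈)
  sumsUpTo-⊕-origin∷ k x∈ (there d∈S) = sumsUpTo-⊕ k x∈ d∈S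

  -- One step contributes (T ⊓ c) · t; the remaining (c ∸ T) · t is a sum of k steps.
  multiple∈sumsUpTo : ∀ {t T} → (∀ {c} → c ≤ T → (+ c) · t ∈ origin ∷ S) →
                      ∀ k {c} → c ≤ k * T → (+ c) · t ∈ sumsUpTo S k
  multiple∈sumsUpTo _ zero z≤n = here refl
  multiple∈sumsUpTo {t} {T} steps (suc k) {c} c≤T+kT =
    subst (_∈ sumsUpTo S (suc k)) split
      (sumsUpTo-⊕-origin∷ k (multiple∈sumsUpTo steps k (ℕ.m≤n+o⇒m∸n≤o c T c≤T+kT)) (steps (ℕ.m⊓n≤m T c)))
    where
    split : ((+ (c ∸ T)) · t) ⊕ ((+ (T ℕ.⊓ c)) · t) ≡ (+ c) · t
    split = begin
      ((+ (c ∸ T)) · t) ⊕ ((+ (T ℕ.⊓ c)) · t)  ≡⟨ ·-distribʳ-+ (+ (c ∸ T)) (+ (T ℕ.⊓ c)) t ⟩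
      (+ (c ∸ T) ℤ.+ + (T ℕ.⊓ c)) · t     ≡⟨ cong (_· t) (ℤ.pos-+ (c ∸ T) (T ℕ.⊓ c)) ⟨
      (+ (c ∸ T + T ℕ.⊓ c)) · t
        ≡⟨ cong (λ n → (+ n) · t) (trans (ℕ.+-comm (c ∸ T) (T ℕ.⊓ c)) (ℕ.m⊓n+n∸m≡n T c)) ⟩
      (+ c) · t                           ∎
      where open ≡-Reasoning

  multiple⊕∈sumsUpTo : ∀ {a b} → a ∈ S → b ∈ S → ∀ j → ((+ j) · a) ⊕ b ∈ sumsUpTo S (suc j)
  multiple⊕∈sumsUpTo a∈S b∈S zero = sumsUpTo-⊕ 0 (here refl) b∈S
  multiple⊕∈sumsUpTo {a} {b} a∈S b∈S (suc j) = subst (_∈ sumsUpTo S (suc (suc j))) (sym (·-suc-⊕ j a b))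
    (sumsUpTo-⊕ (suc j) (multiple⊕∈sumsUpTo a∈S b∈S j) a∈S)

sumsUpTo-⊆ : ∀ {S S′} → S ⊆ S′ → ∀ k → sumsUpTo S k ⊆ sumsUpTo S′ k
sumsUpTo-⊆ {S} {S′} S⊆S′ k =
  sumsUpTo-ind S (λ k x → x ∈ sumsUpTo S′ k) (here refl)
    (λ {k} → sumsUpTo-mono S′ (ℕ.n≤1+n k)) (λ {k} x∈ d∈S → sumsUpTo-⊕ S′ k x∈ (S⊆S′ d∈S)) k

nonzeroSums : ℕ → List Point → List Point
nonzeroSums k S = deduplicate _≟P_ (filter (λ p → ¬? (p ≟P origin)) (sumsUpTo S k))

∈-nonzeroSums⁺ : ∀ k S {x} → x ∈ sumsUpTo S k → x ≢ origin → x ∈ nonzeroSums k S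
∈-nonzeroSums⁺ k S x∈ x≢0 = ∈-deduplicate⁺ _≟P_ (∈-filter⁺ (λ p → ¬? (p ≟P origin)) x∈ x≢0)

∈-nonzeroSums⁻ : ∀ k S {x} → x ∈ nonzeroSums k S → x ∈ sumsUpTo S k × x ≢ origin
∈-nonzeroSums⁻ k S x∈ =
  ∈-filter⁻ (λ p → ¬? (p ≟P origin)) (∈-deduplicate⁻ _≟P_ (filter (λ p → ¬? (p ≟P origin)) (sumsUpTo S k)) x∈)

nonzeroSums-unique : ∀ k S → Unique (nonzeroSums k S)
nonzeroSums-unique k S = deduplicate-! (filter (λ p → ¬? (p ≟P origin)) (sumsUpTo S k))

nonzeroSums-⊆ : ∀ {S S′} → S ⊆ S′ → ∀ k → nonzeroSums k S ⊆ nonzeroSums k S′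
nonzeroSums-⊆ {S} {S′} S⊆S′ k x∈ with ∈-nonzeroSums⁻ k S x∈
... | x∈sums , x≢0 = ∈-nonzeroSums⁺ k S′ (sumsUpTo-⊆ S⊆S′ k x∈sums) x≢0

length-nonzeroSums-cong : ∀ {S S′} → S ⊆ S′ → S′ ⊆ S → ∀ k → length (nonzeroSums k S) ≡ length (nonzeroSums k S′)
length-nonzeroSums-cong S⊆S′ S′⊆S k =
  unique-⊆-⊇⇒length≡ (nonzeroSums-unique k _) (nonzeroSums-unique k _) (nonzeroSums-⊆ S⊆S′ k) (nonzeroSums-⊆ S′⊆S k)

IsDD⇒injective : ∀ {m} {D : Fin m → Point} → IsDD D → ∀ {i j} → i ≢ j → D i ≢ D j
IsDD⇒injective {D = D} dd {i} {j} i≢j Di≡Dj =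
  i≢j (proj₁ (dd i j j i i≢j (i≢j ∘ sym) (begin
    D i ⊖ D j  ≡⟨ cong (_⊖ D j) Di≡Dj ⟩
    D j ⊖ D j  ≡⟨ p⊖p≡origin (D j) ⟩
    origin     ≡⟨ p⊖p≡origin (D i) ⟨
    D i ⊖ D i  ≡⟨ cong (_⊖ D i) Di≡Dj ⟩
    D j ⊖ D i  ∎)))
  where open ≡-Reasoning

∈-diffs⁻ : ∀ {m} (D : Fin m → Point) {x} → x ∈ diffs D → ∃ λ i → ∃ λ j → i ≢ j × D i ⊖ D j ≡ x
∈-diffs⁻ {m} D x∈ with find (∈-concatMap⁻ _ {xs = allFin m} x∈)
... | i , _ , x∈row with find (∈-concatMap⁻ _ {xs = allFin m} x∈row)
...   | j , _ , x∈pick with i Fin.≟ j | x∈pick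
...     | yes _ | ()
...     | no i≢j | here refl = i , j , i≢j , refl

-- `diffs` is built from a local helper that cannot be named here, so membership is shown by
-- contradiction: the failing `All` is pushed down to the helper's value at (i , j), whose type
-- then contains `i Fin.≟ j` for the `with` to compute it.
∈-diffs⁺ : ∀ {m} (D : Fin m → Point) {i j} → i ≢ j → D i ⊖ D j ∈ diffs D
∈-diffs⁺ D {i} {j} i≢j with Any.any? ((D i ⊖ D j) ≟P_) (diffs D)
... | yes Dij∈ = Dij∈
... | no Dij∉
  with i Fin.≟ j
     | All.lookup (map⁻ (concat⁻ (All.lookup (map⁻ (concat⁻ (¬Any⇒All¬ (diffs D) Dij∉))) (∈-allFin i)))) (∈-allFin j)
...   | yes i≡j | _ = ⊥-elim (i≢j i≡j)
...   | no _ | Dij≢Dij All.∷ All.[] = ⊥-elim (Dij≢Dij refl)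

module _ {n} (D : Fin (suc n) → Point) where

  differences : List Point
  differences = cartesianProductWith (λ i j → D i ⊖ D (punchIn i j)) (allFin (suc n)) (allFin n)

  ∈-differences⁺ : ∀ {i j} → i ≢ j → D i ⊖ D j ∈ differences
  ∈-differences⁺ {i} {j} i≢j = subst (λ j′ → D i ⊖ D j′ ∈ differences) (punchIn-punchOut i≢j)
    (∈-cartesianProductWith⁺ (λ i j → D i ⊖ D (punchIn i j)) (∈-allFin i) (∈-allFin (punchOut i≢j)))

  ∈-differences⁻ : ∀ {x} → x ∈ differences → ∃ λ i → ∃ λ j → i ≢ j × D i ⊖ D j ≡ x
  ∈-differences⁻ x∈ with ∈-cartesianProductWith⁻ (λ i j → D i ⊖ D (punchIn i j)) (allFin (suc n)) (allFin n) x∈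
  ... | i , j , _ , _ , refl = i , punchIn i j , punchInᵢ≢i i j ∘ sym , refl

  length-differences : length differences ≡ suc n * n
  length-differences = begin
    length differences                       ≡⟨ length-cartesianProductWith _ (allFin (suc n)) (allFin n) ⟩
    length (allFin (suc n)) * length (allFin n)
      ≡⟨ cong₂ _*_ (List.length-tabulate {n = suc n} id) (List.length-tabulate {n = n} id) ⟩
    suc n * n                                ∎
    where open ≡-Reasoning

  differences-unique : IsDD D → Unique differences
  differences-unique dd = Unique.cartesianProductWith⁺ _ injective (Unique.allFin⁺ (suc n)) (Unique.allFin⁺ n)
    where
    injective : ∀ {i i′ j j′} → D i ⊖ D (punchIn i j) ≡ D i′ ⊖ D (punchIn i′ j′) → i ≡ i′ × j ≡ j′
    injective {i} {i′} e with dd _ _ _ _ (punchInᵢ≢i i _ ∘ sym) (punchInᵢ≢i i′ _ ∘ sym) e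
    ... | refl , punchIns≡ = refl , punchIn-injective i _ _ punchIns≡

  differences-≢origin : IsDD D → ∀ {x} → x ∈ differences → x ≢ origin
  differences-≢origin dd x∈ with ∈-differences⁻ x∈
  ... | i , j , i≢j , refl = λ Di⊖Dj≡0 → IsDD⇒injective dd i≢j (p⊖q≡origin⇒p≡q (D i) (D j) Di⊖Dj≡0)

  differences-neg : ∀ {x} → x ∈ differences → neg x ∈ differences
  differences-neg x∈ with ∈-differences⁻ x∈
  ... | i , j , i≢j , refl = subst (_∈ differences) (sym (neg[p⊖q]≡q⊖p (D i) (D j))) (∈-differences⁺ (i≢j ∘ sym))

  diffs⊆differences : diffs D ⊆ differences
  diffs⊆differences x∈ with ∈-diffs⁻ D x∈
  ... | i , j , i≢j , refl = ∈-differences⁺ i≢j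

  differences⊆diffs : differences ⊆ diffs D
  differences⊆diffs x∈ with ∈-differences⁻ x∈
  ... | i , j , i≢j , refl = ∈-diffs⁺ D i≢j

  coverage≡length-nonzeroSums : ∀ k → coverage k D ≡ length (nonzeroSums k differences)
  coverage≡length-nonzeroSums = length-nonzeroSums-cong diffs⊆differences differences⊆diffs

-- Symmetric progressions

BoundedMultiple : ℕ → Point → Point → Set
BoundedMultiple N s x = ∃ λ c → c ≢ 0ℤ × ℤ.∣ c ∣ ≤ N × x ≡ c · s

record IsProgression (S : List Point) (s : Point) (T : ℕ) : Set where
  field
    step≢origin : s ≢ origin
    ⊆progression : ∀ {x} → x ∈ S → BoundedMultiple T s x
    progression⊆ : ∀ {x} → BoundedMultiple T s x → x ∈ S

module _ (s : Point) where

  positiveMultiples : ℕ → List Point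
  positiveMultiples N = map (λ c → (+ suc c) · s) (upTo N)

  multiples : ℕ → List Point
  multiples N = positiveMultiples N ++ map (λ c → -[1+ c ] · s) (upTo N)

  length-positiveMultiples : ∀ N → length (positiveMultiples N) ≡ N
  length-positiveMultiples N = trans (List.length-map _ (upTo N)) (List.length-upTo N)

  length-multiples : ∀ N → length (multiples N) ≡ N + N
  length-multiples N = trans (List.length-++ (positiveMultiples N))
    (cong₂ _+_ (length-positiveMultiples N) (trans (List.length-map _ (upTo N)) (List.length-upTo N)))

  ∈-multiples⁺ : ∀ {N x} → BoundedMultiple N s x → x ∈ multiples N
  ∈-multiples⁺ (+ zero , c≢0 , _ , _) = ⊥-elim (c≢0 refl)
  ∈-multiples⁺ (+ suc c , _ , c<N , refl) = ∈-++⁺ˡ (∈-map⁺ (λ c → (+ suc c) · s) (∈-upTo⁺ c<N))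
  ∈-multiples⁺ {N} (-[1+ c ] , _ , c<N , refl) =
    ∈-++⁺ʳ (positiveMultiples N) (∈-map⁺ (λ c → -[1+ c ] · s) (∈-upTo⁺ c<N))

  ∈-multiples⁻ : ∀ {N x} → x ∈ multiples N → BoundedMultiple N s x
  ∈-multiples⁻ {N} x∈ with ∈-++⁻ (positiveMultiples N) x∈
  ... | inj₁ x∈pos with ∈-map⁻ _ x∈pos
  ...   | c , c∈ , refl = + suc c , (λ ()) , ∈-upTo⁻ c∈ , refl
  ∈-multiples⁻ {N} x∈ | inj₂ x∈neg with ∈-map⁻ _ x∈neg
  ...   | c , c∈ , refl = -[1+ c ] , (λ ()) , ∈-upTo⁻ c∈ , refl

  module _ (s≢0 : s ≢ origin) where

    positiveMultiples-unique : ∀ N → Unique (positiveMultiples N)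
    positiveMultiples-unique N =
      Unique.map⁺ (λ e → ℕ.suc-injective (ℤ.+-injective (·-cancelʳ s≢0 _ _ e))) (Unique.upTo⁺ N)

    multiples-unique : ∀ N → Unique (multiples N)
    multiples-unique N = Unique.++⁺ (positiveMultiples-unique N)
      (Unique.map⁺ (λ e → ℤ.-[1+-injective (·-cancelʳ s≢0 _ _ e)) (Unique.upTo⁺ N))
      λ (x∈pos , x∈neg) → sign-clash (∈-map⁻ _ x∈pos) (∈-map⁻ _ x∈neg)
      where
      sign-clash : ∀ {x} → (∃ λ c → c ∈ upTo N × x ≡ (+ suc c) · s) →
                          (∃ λ c → c ∈ upTo N × x ≡ -[1+ c ] · s) → ⊥
      sign-clash (c , _ , refl) (c′ , _ , e) with ·-cancelʳ s≢0 (+ suc c) -[1+ c′ ] e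
      ... | ()

module _ {S : List Point} {s : Point} {T : ℕ} (progression : IsProgression S s T) where

  open IsProgression progression renaming (step≢origin to s≢0; ⊆progression to S⊆; progression⊆ to S⊇)

  private
    multiples-of : ∀ t → (∀ {c} → suc c ≤ T → (+ suc c) · t ∈ S) → ∀ {c} → c ≤ T → (+ c) · t ∈ origin ∷ S
    multiples-of t _ {zero} _ = here refl
    multiples-of t t-steps {suc c} c<T = there (t-steps c<T)

    sums⊇ : ∀ k {x} → BoundedMultiple (k * T) s x → x ∈ sumsUpTo S k
    sums⊇ k (+ c , _ , c≤kT , refl) =
      multiple∈sumsUpTo S (multiples-of s (λ {c} c<T → S⊇ (+ suc c , (λ ()) , c<T , refl))) k c≤kT
    sums⊇ k (-[1+ c ] , _ , c<kT , refl) =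
      subst (_∈ sumsUpTo S k) (·-neg (+ suc c) s)
        (multiple∈sumsUpTo S (multiples-of (neg s) (λ {c} c<T → S⊇ (-[1+ c ] , (λ ()) , c<T , ·-neg (+ suc c) s))) k c<kT)

    SumOfMultiples : ℕ → Point → Set
    SumOfMultiples k x = ∃ λ c → ℤ.∣ c ∣ ≤ k * T × x ≡ c · s

    sums⊆ : ∀ k {x} → x ∈ sumsUpTo S k → SumOfMultiples k x
    sums⊆ = sumsUpTo-ind S SumOfMultiples (0ℤ , z≤n , refl)
      (λ {k} (c , c≤kT , x≡cs) → c , ℕ.≤-trans c≤kT (ℕ.m≤n+m (k * T) T) , x≡cs)
      (λ { {k} (c , c≤kT , refl) d∈S → step k c c≤kT (S⊆ d∈S) })
      where
      step : ∀ k c {d} → ℤ.∣ c ∣ ≤ k * T → BoundedMultiple T s d → SumOfMultiples (suc k) ((c · s) ⊕ d)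
      step k c c≤kT (c′ , _ , c′≤T , refl) =
        c ℤ.+ c′ ,
        ℕ.≤-trans (ℤ.∣i+j∣≤∣i∣+∣j∣ c c′) (ℕ.≤-trans (ℕ.+-mono-≤ c≤kT c′≤T) (ℕ.≤-reflexive (ℕ.+-comm (k * T) T))) ,
        ·-distribʳ-+ c c′ s

  length-progression : Unique S → length S ≡ T + T
  length-progression S-unique = trans
    (unique-⊆-⊇⇒length≡ S-unique (multiples-unique s s≢0 T) (∈-multiples⁺ s ∘ S⊆) (S⊇ ∘ ∈-multiples⁻ s))
    (length-multiples s T)

  length-nonzeroSums-progression : ∀ k → length (nonzeroSums k S) ≡ k * (T + T)
  length-nonzeroSums-progression k = begin
    length (nonzeroSums k S)
      ≡⟨ unique-⊆-⊇⇒length≡ (nonzeroSums-unique k S) (multiples-unique s s≢0 (k * T)) sums⊆multiples multiples⊆sums ⟩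
    length (multiples s (k * T)) ≡⟨ length-multiples s (k * T) ⟩
    k * T + k * T              ≡⟨ ℕ.*-distribˡ-+ k T T ⟨
    k * (T + T)                ∎
    where
    open ≡-Reasoning
    sums⊆multiples : nonzeroSums k S ⊆ multiples s (k * T)
    sums⊆multiples x∈ with ∈-nonzeroSums⁻ k S x∈
    ... | x∈sums , x≢0 with sums⊆ k x∈sums
    ...   | c , c≤kT , refl = ∈-multiples⁺ s (c , (λ { refl → x≢0 refl }) , c≤kT , refl)
    multiples⊆sums : multiples s (k * T) ⊆ nonzeroSums k S
    multiples⊆sums x∈ with ∈-multiples⁻ s x∈
    ... | c , c≢0 , c≤kT , refl = ∈-nonzeroSums⁺ k S (sums⊇ k (c , c≢0 , c≤kT , refl)) (·-≢origin s≢0 c≢0)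

-- Configurations whose difference list is a progression

module _ {n} (D : Fin (suc n) → Point) (dd : IsDD D) where

  progression⇒coverage : ∀ {s T} → IsProgression (differences D) s T → ∀ k → coverage k D ≡ k * (suc n * n)
  progression⇒coverage {s} {T} progression k = begin
    coverage k D                              ≡⟨ coverage≡length-nonzeroSums D k ⟩
    length (nonzeroSums k (differences D))    ≡⟨ length-nonzeroSums-progression progression k ⟩
    k * (T + T)                               ≡⟨ cong (k *_) (length-progression progression (differences-unique D dd)) ⟨
    k * length (differences D)                ≡⟨ cong (k *_) (length-differences D) ⟩
    k * (suc n * n)                           ∎
    where open ≡-Reasoning

  module _ {n′} {M : Fin n′ → ℤ} (perfect : IsPerfect M) {r s : Point}
           (D≈M : ∀ p → (∃ λ i → D i ≡ p) ⇔ (∃ λ j → r ⊕ (M j · s) ≡ p)) where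

    private
      difference-as-multiple : ∀ i j → ∃ λ u → ∃ λ v → D i ⊖ D j ≡ (M u ℤ.- M v) · s
      difference-as-multiple i j =
        let (u , Dᵤ) = to (D≈M (D i)) (i , refl) ; (v , Dᵥ) = to (D≈M (D j)) (j , refl) in
        u , v , trans (cong₂ _⊖_ (sym Dᵤ) (sym Dᵥ)) (affine-⊖ r (M u) (M v) s)

      s≢origin : ∀ {i j : Fin (suc n)} → i ≢ j → s ≢ origin
      s≢origin {i} {j} i≢j refl =
        let (u , v , Dᵢ-Dⱼ) = difference-as-multiple i j in
        differences-≢origin D dd (∈-differences⁺ D i≢j) (trans Dᵢ-Dⱼ (·-zeroʳ (M u ℤ.- M v)))

    perfectGolomb⇒progression : ∀ {i j : Fin (suc n)} → i ≢ j → IsProgression (differences D) s ((n′ * (n′ ∸ 1)) ℕ./ 2)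
    perfectGolomb⇒progression i≢j = record
      { step≢origin = s≢origin i≢j
      ; ⊆progression = differences⊆progression
      ; progression⊆ = progression⊆differences
      }
      where
      differences⊆progression : ∀ {x} → x ∈ differences D → BoundedMultiple _ s x
      differences⊆progression {x} x∈ =
        let (i , j , _ , Dᵢ-Dⱼ≡x) = ∈-differences⁻ D x∈ ; (u , v , Dᵢ-Dⱼ≡) = difference-as-multiple i j in
        M u ℤ.- M v , c≢0 (trans (sym Dᵢ-Dⱼ≡x) Dᵢ-Dⱼ≡) , to (perfect _) (u , v , refl) ,
        trans (sym Dᵢ-Dⱼ≡x) Dᵢ-Dⱼ≡
        where
        c≢0 : ∀ {c} → x ≡ c · s → c ≢ 0ℤ
        c≢0 x≡cs c≡0 = differences-≢origin D dd x∈ (trans x≡cs (cong (_· s) c≡0))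

      progression⊆differences : ∀ {x} → BoundedMultiple _ s x → x ∈ differences D
      progression⊆differences (c , c≢0 , c≤T , refl) =
        let (u , v , Mᵤ-Mᵥ≡c) = from (perfect c) c≤T
            (i , Dᵢ) = from (D≈M _) (u , refl)
            (j , Dⱼ) = from (D≈M _) (v , refl) in
        pair (trans (cong₂ _⊖_ Dᵢ Dⱼ) (trans (affine-⊖ r (M u) (M v) s) (cong (_· s) Mᵤ-Mᵥ≡c)))
        where
        pair : ∀ {i j} → D i ⊖ D j ≡ c · s → c · s ∈ differences D
        pair {i} {j} Dᵢ-Dⱼ≡cs = subst (_∈ differences D) Dᵢ-Dⱼ≡cs (∈-differences⁺ D i≢j′)
          where
          i≢j′ : i ≢ j
          i≢j′ refl = ·-≢origin (s≢origin i≢j) c≢0 (trans (sym Dᵢ-Dⱼ≡cs) (p⊖p≡origin (D i)))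

  module _ {p T} (progression : IsProgression (differences D) p T) where

    open IsProgression progression

    private
      coefficient : ∀ i → ∃ λ c → D i ⊖ D Fin.zero ≡ c · p
      coefficient i = case i Fin.≟ Fin.zero of λ where
        (yes refl) → 0ℤ , p⊖p≡origin (D Fin.zero)
        (no i≢0) → let (c , _ , _ , Dᵢ-D₀≡) = ⊆progression (∈-differences⁺ D i≢0) in c , Dᵢ-D₀≡

      opaque
        M : Fin (suc n) → ℤ
        M i = proj₁ (coefficient i)

        D≡ : ∀ i → D i ≡ D Fin.zero ⊕ (M i · p)
        D≡ i = trans (sym (p⊕[q⊖p]≡q (D Fin.zero) (D i))) (cong (D Fin.zero ⊕_) (proj₂ (coefficient i)))

      difference≡ : ∀ i j → D i ⊖ D j ≡ (M i ℤ.- M j) · p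
      difference≡ i j = trans (cong₂ _⊖_ (D≡ i) (D≡ j)) (affine-⊖ (D Fin.zero) (M i) (M j) p)

      ruler-difference : ∀ {i j} → i ≢ j → ∃ λ c → c ≢ 0ℤ × ℤ.∣ c ∣ ≤ T × M i ℤ.- M j ≡ c
      ruler-difference {i} {j} i≢j =
        let (c , c≢0 , c≤T , Dᵢ-Dⱼ≡) = ⊆progression (∈-differences⁺ D i≢j) in
        c , c≢0 , c≤T , ·-cancelʳ step≢origin _ c (trans (sym (difference≡ i j)) Dᵢ-Dⱼ≡)

      T≡ : (suc n * n) ℕ./ 2 ≡ T
      T≡ = begin
        (suc n * n) ℕ./ 2          ≡⟨ cong (ℕ._/ 2) (length-differences D) ⟨
        length (differences D) ℕ./ 2 ≡⟨ cong (ℕ._/ 2) (length-progression progression (differences-unique D dd)) ⟩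
        (T + T) ℕ./ 2              ≡⟨ cong (ℕ._/ 2) (trans (cong (_+_ T) (sym (ℕ.+-identityʳ T))) (ℕ.*-comm 2 T)) ⟩
        (T * 2) ℕ./ 2              ≡⟨ m*n/n≡m T 2 ⟩
        T                          ∎
        where open ≡-Reasoning

    golomb : IsGolomb M
    golomb i j k l i≢j k≢l e = dd i j k l i≢j k≢l (trans (difference≡ i j) (trans (cong (_· p) e) (sym (difference≡ k l))))

    perfect : IsPerfect M
    perfect z = mk⇔ (subst (ℤ.∣ z ∣ ≤_) (sym T≡) ∘ bounded) (realised ∘ subst (ℤ.∣ z ∣ ≤_) T≡)
      where
      bounded : (∃ λ u → ∃ λ v → M u ℤ.- M v ≡ z) → ℤ.∣ z ∣ ≤ T
      bounded (u , v , refl) = case u Fin.≟ v of λ where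
        (yes refl) → subst (λ w → ℤ.∣ w ∣ ≤ T) (sym (ℤ.+-inverseʳ (M u))) z≤n
        (no u≢v) → let (c , _ , c≤T , Mᵤ-Mᵥ≡c) = ruler-difference u≢v in
          subst (λ w → ℤ.∣ w ∣ ≤ T) (sym Mᵤ-Mᵥ≡c) c≤T
      realised : ℤ.∣ z ∣ ≤ T → ∃ λ u → ∃ λ v → M u ℤ.- M v ≡ z
      realised z≤T = case z ℤ.≟ 0ℤ of λ where
        (yes refl) → Fin.zero , Fin.zero , ℤ.+-inverseʳ (M Fin.zero)
        (no z≢0) → let (i , j , _ , Dᵢ-Dⱼ≡) = ∈-differences⁻ D (progression⊆ (z , z≢0 , z≤T , refl)) in
          i , j , ·-cancelʳ step≢origin _ z (trans (sym (difference≡ i j)) Dᵢ-Dⱼ≡)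

    progression⇒perfectGolomb : EquivPerfectGolomb D
    progression⇒perfectGolomb = suc n , M , golomb , perfect , D Fin.zero , p , λ q →
      mk⇔ (λ (i , Dᵢ≡q) → i , trans (sym (D≡ i)) Dᵢ≡q) (λ (j , ≡q) → j , trans (D≡ j) ≡q)

-- Symmetric sets of extremal coverage

± : List Point → List Point
± xs = xs ++ map neg xs

length-± : ∀ xs → length (± xs) ≡ length xs + length xs
length-± xs = trans (List.length-++ xs) (cong (_+_ (length xs)) (List.length-map neg xs))

∈-±⁻ : ∀ {xs x} → x ∈ ± xs → x ∈ xs ⊎ neg x ∈ xs
∈-±⁻ {xs} x∈ with ∈-++⁻ xs x∈
... | inj₁ x∈xs = inj₁ x∈xs
... | inj₂ x∈-xs with ∈-map⁻ neg x∈-xs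
...   | y , y∈xs , refl = inj₂ (subst (_∈ xs) (sym (neg-involutive y)) y∈xs)

±-unique : ∀ {xs} → Unique xs → (∀ {x} → x ∈ xs → Positive x) → Unique (± xs)
±-unique {xs} xs-unique xs-positive = Unique.++⁺ xs-unique (Unique.map⁺ neg-injective xs-unique)
  λ (x∈xs , x∈-xs) → let (y , y∈xs , x≡-y) = ∈-map⁻ neg x∈-xs in
    Positive⇒¬Positive-neg (xs-positive y∈xs) (subst Positive x≡-y (xs-positive x∈xs))

module SymmetricSet {S : List Point} (S≢0 : ∀ {x} → x ∈ S → x ≢ origin) (S-neg : ∀ {x} → x ∈ S → neg x ∈ S) where

  positivePart : List Point
  positivePart = filter Positive? S

  positivePart⊆ : ∀ {x} → x ∈ positivePart → x ∈ S × Positive x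
  positivePart⊆ = ∈-filter⁻ Positive?

  ∈-positivePart⁺ : ∀ {x} → x ∈ S → Positive x → x ∈ positivePart
  ∈-positivePart⁺ = ∈-filter⁺ Positive?

  ±positivePart⊆ : ± positivePart ⊆ S
  ±positivePart⊆ x∈ with ∈-±⁻ x∈
  ... | inj₁ x∈P = proj₁ (positivePart⊆ x∈P)
  ... | inj₂ -x∈P = subst (_∈ S) (neg-involutive _) (S-neg (proj₁ (positivePart⊆ -x∈P)))

  ⊆±positivePart : S ⊆ ± positivePart
  ⊆±positivePart {x} x∈S with Positive-trichotomy x
  ... | inj₁ x>0 = ∈-++⁺ˡ (∈-positivePart⁺ x∈S x>0)
  ... | inj₂ (inj₁ x≡0) = ⊥-elim (S≢0 x∈S x≡0)
  ... | inj₂ (inj₂ -x>0) = ∈-++⁺ʳ positivePart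
          (subst (_∈ map neg positivePart) (neg-involutive x) (∈-map⁺ neg (∈-positivePart⁺ (S-neg x∈S) -x>0)))

  length-positivePart : Unique S → length S ≡ length positivePart + length positivePart
  length-positivePart S-unique = trans
    (unique-⊆-⊇⇒length≡ S-unique (±-unique (Unique.filter⁺ Positive? S-unique) (proj₂ ∘ positivePart⊆))
                        ⊆±positivePart ±positivePart⊆)
    (length-± positivePart)

module _ {k} (k≥2 : 2 ≤ k) {S : List Point} (S-unique : Unique S)
         (S≢0 : ∀ {x} → x ∈ S → x ≢ origin) (S-neg : ∀ {x} → x ∈ S → neg x ∈ S)
         (extremal : length (nonzeroSums k S) ≡ k * length S) {x₀} (x₀∈S : x₀ ∈ S) where

  open SymmetricSet S≢0 S-neg

  private
    P : List Point
    P = positivePart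

    P-unique : Unique P
    P-unique = Unique.filter⁺ Positive? S-unique

    P⊆S : ∀ {p} → p ∈ P → p ∈ S
    P⊆S = proj₁ ∘ positivePart⊆

    P-positive : ∀ {p} → p ∈ P → Positive p
    P-positive = proj₂ ∘ positivePart⊆

    some∈P : ∃ λ p → p ∈ P
    some∈P with Positive-trichotomy x₀
    ... | inj₁ x₀>0 = x₀ , ∈-positivePart⁺ x₀∈S x₀>0
    ... | inj₂ (inj₁ x₀≡0) = ⊥-elim (S≢0 x₀∈S x₀≡0)
    ... | inj₂ (inj₂ -x₀>0) = neg x₀ , ∈-positivePart⁺ (S-neg x₀∈S) -x₀>0

    opaque
      greatest : ∃ λ g → g ∈ P × (∀ {p} → p ∈ P → p ≼ g)
      greatest = ∃-greatest {_≤_ = _≼_} ≼-total (λ {p} {q} {r} → ≼-trans {p} {q} {r}) (proj₂ some∈P)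

      least : ∃ λ l → l ∈ P × (∀ {p} → p ∈ P → l ≼ p)
      least = ∃-greatest {_≤_ = flip _≼_} (λ p q → ≼-total q p)
                (λ {p} {q} {r} q≼p r≼q → ≼-trans {r} {q} {p} r≼q q≼p) (proj₂ some∈P)

    maxP : Point
    maxP = proj₁ greatest

    maxP∈P : maxP ∈ P
    maxP∈P = proj₁ (proj₂ greatest)

    ≼maxP : ∀ {p} → p ∈ P → p ≼ maxP
    ≼maxP = proj₂ (proj₂ greatest)

    minP : Point
    minP = proj₁ least

    minP∈P : minP ∈ P
    minP∈P = proj₁ (proj₂ least)

    minP≼ : ∀ {p} → p ∈ P → minP ≼ p
    minP≼ = proj₂ (proj₂ least)

    row : ℕ → Point → Point
    row j p = ((+ j) · maxP) ⊕ p

    row-positive : ∀ j {p} → p ∈ P → Positive (row j p)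
    row-positive j p∈P = NonNegative-⊕-Positive (NonNegative-· (P-positive maxP∈P) j) (P-positive p∈P)

    row-gap>0 : ∀ j d {p p′} → p ∈ P → p′ ∈ P → Positive (row (suc (j + d)) p′ ⊖ row j p)
    row-gap>0 j d {p} {p′} p∈P p′∈P = subst Positive (sym gap)
      (NonNegative-⊕-Positive (NonNegative-⊕ (NonNegative-· (P-positive maxP∈P) d) (≼maxP p∈P)) (P-positive p′∈P))
      where
      gap : row (suc (j + d)) p′ ⊖ row j p ≡ (((+ d) · maxP) ⊕ (maxP ⊖ p)) ⊕ p′
      gap = cong₂ _,_ (lemma (+ j) (+ d) (proj₁ maxP) (proj₁ p) (proj₁ p′))
                      (lemma (+ j) (+ d) (proj₂ maxP) (proj₂ p) (proj₂ p′))
        where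
        lemma : ∀ J D a x y →
                ((ℤ.1ℤ ℤ.+ (J ℤ.+ D)) ℤ.* a ℤ.+ y) ℤ.- (J ℤ.* a ℤ.+ x) ≡ (D ℤ.* a ℤ.+ (a ℤ.- x)) ℤ.+ y
        lemma = solve-∀

    rows-disjoint : ∀ {j j′ p p′} → j < j′ → p ∈ P → p′ ∈ P → row j p ≢ row j′ p′
    rows-disjoint {j} {j′} {p} {p′} j<j′ p∈P p′∈P rowⱼ≡rowⱼ′ =
      let (d , 1+j+d≡j′) = ℕ.m≤n⇒∃[o]m+o≡n j<j′ in
      Positive⇒≢origin (subst (λ j′ → Positive (row j′ p′ ⊖ row j p)) 1+j+d≡j′ (row-gap>0 j d p∈P p′∈P))
        (trans (cong (row j′ p′ ⊖_) rowⱼ≡rowⱼ′) (p⊖p≡origin (row j′ p′)))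

    row-cancel : ∀ {j j′ p p′} → j ≡ j′ → row j p ≡ row j′ p′ → p ≡ p′
    row-cancel {j} {p = p} {p′} refl e = begin
      p                             ≡⟨ [p⊕q]⊖p≡q ((+ j) · maxP) p ⟨
      row j p ⊖ ((+ j) · maxP)      ≡⟨ cong (_⊖ ((+ j) · maxP)) e ⟩
      row j p′ ⊖ ((+ j) · maxP)     ≡⟨ [p⊕q]⊖p≡q ((+ j) · maxP) p′ ⟩
      p′                            ∎
      where open ≡-Reasoning

    row-injective : ∀ {j j′ p p′} → j ∈ upTo k → j′ ∈ upTo k → p ∈ P → p′ ∈ P →
                    row j p ≡ row j′ p′ → j ≡ j′ × p ≡ p′
    row-injective {j} {j′} _ _ p∈P p′∈P e = case ℕ.<-cmp j j′ of λ where
      (tri< j<j′ _ _) → ⊥-elim (rows-disjoint j<j′ p∈P p′∈P e)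
      (tri> _ _ j′<j) → ⊥-elim (rows-disjoint j′<j p′∈P p∈P (sym e))
      (tri≈ _ j≡j′ _) → j≡j′ , row-cancel j≡j′ e

    E⁺ : List Point
    E⁺ = cartesianProductWith row (upTo k) P

    E⁺-all : ∀ {Q : Point → Set} → (∀ {j p} → j < k → p ∈ P → Q (row j p)) → ∀ {x} → x ∈ E⁺ → Q x
    E⁺-all {Q} Q-row x∈ = elim (∈-cartesianProductWith⁻ row (upTo k) P x∈)
      where
      elim : ∀ {x} → (∃ λ j → ∃ λ p → j ∈ upTo k × p ∈ P × x ≡ row j p) → Q x
      elim (j , p , j∈ , p∈P , refl) = Q-row (∈-upTo⁻ j∈) p∈P

    E⁺-positive : ∀ {x} → x ∈ E⁺ → Positive x
    E⁺-positive = E⁺-all {Positive} (λ {j} _ p∈P → row-positive j p∈P)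

    E⁺⊆sums : ∀ {x} → x ∈ E⁺ → x ∈ sumsUpTo S k
    E⁺⊆sums = E⁺-all {_∈ sumsUpTo S k} λ {j} j<k p∈P →
      sumsUpTo-mono S j<k (multiple⊕∈sumsUpTo S (P⊆S maxP∈P) (P⊆S p∈P) j)

    -E⁺⊆sums : ∀ {x} → x ∈ E⁺ → neg x ∈ sumsUpTo S k
    -E⁺⊆sums = E⁺-all {λ x → neg x ∈ sumsUpTo S k} λ {j} {p} j<k p∈P →
      subst (_∈ sumsUpTo S k) (sym (neg-·-⊕ (+ j) maxP p))
      (sumsUpTo-mono S j<k (multiple⊕∈sumsUpTo S (S-neg (P⊆S maxP∈P)) (S-neg (P⊆S p∈P)) j))

    E : List Point
    E = ± E⁺

    E-unique : Unique E
    E-unique = ±-unique (cartesianProductWith-unique row row-injective (Unique.upTo⁺ k) P-unique) E⁺-positive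

    length-E : length E ≡ k * length S
    length-E = begin
      length (± E⁺)                  ≡⟨ length-± E⁺ ⟩
      length E⁺ + length E⁺          ≡⟨ cong₂ _+_ length-E⁺ length-E⁺ ⟩
      k * length P + k * length P    ≡⟨ ℕ.*-distribˡ-+ k (length P) (length P) ⟨
      k * (length P + length P)      ≡⟨ cong (k *_) (length-positivePart S-unique) ⟨
      k * length S                   ∎
      where
      open ≡-Reasoning
      length-E⁺ : length E⁺ ≡ k * length P
      length-E⁺ = trans (length-cartesianProductWith row (upTo k) P) (cong (_* length P) (List.length-upTo k))

    E⊆nonzeroSums : E ⊆ nonzeroSums k S
    E⊆nonzeroSums x∈ with ∈-±⁻ x∈
    ... | inj₁ x∈E⁺ = ∈-nonzeroSums⁺ k S (E⁺⊆sums x∈E⁺) (Positive⇒≢origin (E⁺-positive x∈E⁺))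
    ... | inj₂ -x∈E⁺ = ∈-nonzeroSums⁺ k S (subst (_∈ sumsUpTo S k) (neg-involutive _) (-E⁺⊆sums -x∈E⁺))
                                          (λ { refl → Positive⇒≢origin (E⁺-positive -x∈E⁺) refl })

    nonzeroSums⊆E : nonzeroSums k S ⊆ E
    nonzeroSums⊆E = unique-⊆-length≥⇒⊇ _≟P_ E-unique E⊆nonzeroSums (ℕ.≤-reflexive (trans extremal (sym length-E)))

    E⁺-decomposition : ∀ {x} → x ∈ E⁺ → ∃ λ j → ∃ λ q → q ∈ P × x ≡ row j q
    E⁺-decomposition = E⁺-all {λ x → ∃ λ j → ∃ λ q → q ∈ P × x ≡ row j q} λ {j} {q} _ q∈P → j , q , q∈P , refl

    -- p ⊖ minP is a nonzero 2-sum, hence in E; it is positive, and not in a row j ≥ 1 since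
    -- p ⊖ minP ⊖ maxP is negative.
    ⊖minP∈P : ∀ {p} → p ∈ P → p ≢ minP → p ⊖ minP ∈ P
    ⊖minP∈P {p} p∈P p≢minP = case ∈-±⁻ (nonzeroSums⊆E (∈-nonzeroSums⁺ k S x∈sums x≢0)) of λ where
        (inj₁ x∈E⁺) → in-first-row (E⁺-decomposition x∈E⁺)
        (inj₂ -x∈E⁺) → ⊥-elim (Positive⇒¬Positive-neg x>0 (E⁺-positive -x∈E⁺))
      where
      x : Point
      x = p ⊖ minP

      x∈sums : x ∈ sumsUpTo S k
      x∈sums = sumsUpTo-mono S k≥2 (sumsUpTo-⊕ S 1 (∈⇒∈sumsUpTo S {0} (P⊆S p∈P)) (S-neg (P⊆S minP∈P)))

      x≢0 : x ≢ origin
      x≢0 = p≢minP ∘ p⊖q≡origin⇒p≡q p minP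

      x>0 : Positive x
      x>0 = NonNegative∧≢origin⇒Positive (minP≼ p∈P) x≢0

      in-first-row : (∃ λ j → ∃ λ q → q ∈ P × x ≡ row j q) → x ∈ P
      in-first-row (zero , q , q∈P , x≡q) = subst (_∈ P) (sym (trans x≡q (⊕-identityˡ q))) q∈P
      in-first-row (suc j , q , q∈P , x≡row) =
        ⊥-elim (Positive⇒¬Positive-neg (P-positive minP∈P) (subst Positive telescope maxP-p+x-maxP>0))
        where
        telescope : (maxP ⊖ p) ⊕ (x ⊖ maxP) ≡ neg minP
        telescope = cong₂ _,_ (lemma (proj₁ maxP) (proj₁ p) (proj₁ minP)) (lemma (proj₂ maxP) (proj₂ p) (proj₂ minP))
          where
          lemma : ∀ a y z → (a ℤ.- y) ℤ.+ ((y ℤ.- z) ℤ.- a) ≡ ℤ.- z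
          lemma = solve-∀

        x-maxP≡row : x ⊖ maxP ≡ row j q
        x-maxP≡row = begin
          x ⊖ maxP                   ≡⟨ cong (_⊖ maxP) x≡row ⟩
          row (suc j) q ⊖ maxP       ≡⟨ cong (_⊖ maxP) (·-suc-⊕ j maxP q) ⟩
          (row j q ⊕ maxP) ⊖ maxP    ≡⟨ [p⊕q]⊖q≡p (row j q) maxP ⟩
          row j q                    ∎
          where open ≡-Reasoning
        maxP-p+x-maxP>0 : Positive ((maxP ⊖ p) ⊕ (x ⊖ maxP))
        maxP-p+x-maxP>0 = NonNegative-⊕-Positive (≼maxP p∈P) (subst Positive (sym x-maxP≡row) (row-positive j q∈P))

    below : Point → List Point
    below p = filter (λ y → Positive? (p ⊖ y)) P

    μ : Point → ℕ
    μ p = length (below p)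

    μ-decreasing : ∀ {p} → p ∈ P → p ≢ minP → μ (p ⊖ minP) < μ p
    μ-decreasing {p} p∈P p≢minP =
      unique-⊆⇒length≤ (All.tabulate x∉below ∷ Unique.filter⁺ (λ y → Positive? (x ⊖ y)) P-unique) x∷below⊆below
      where
      x : Point
      x = p ⊖ minP

      p-x>0 : Positive (p ⊖ x)
      p-x>0 = subst Positive (sym (p⊖[p⊖q]≡q p minP)) (P-positive minP∈P)

      x∉below : ∀ {y} → y ∈ below x → x ≢ y
      x∉below y∈ refl = Positive⇒≢origin (proj₂ (∈-filter⁻ (λ y → Positive? (x ⊖ y)) {xs = P} y∈)) (p⊖p≡origin x)

      x∷below⊆below : x ∷ below x ⊆ below p
      x∷below⊆below (here refl) = ∈-filter⁺ (λ y → Positive? (p ⊖ y)) (⊖minP∈P p∈P p≢minP) p-x>0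
      x∷below⊆below {y} (there y∈) =
        let (y∈P , x-y>0) = ∈-filter⁻ (λ y → Positive? (x ⊖ y)) {xs = P} y∈ in
        ∈-filter⁺ (λ y → Positive? (p ⊖ y)) y∈P (subst Positive ([p⊖q]⊕[q⊖r]≡p⊖r p x y) (Positive-⊕ p-x>0 x-y>0))

    multiple-of-minP : ∀ {p} → p ∈ P → ∃ λ c → p ≡ (+ suc c) · minP
    multiple-of-minP p∈P = descend (On.wellFounded μ ℕ.<-wellFounded _) p∈P
      where
      open ≡-Reasoning
      descend : ∀ {p} → Acc (_<_ on μ) p → p ∈ P → ∃ λ c → p ≡ (+ suc c) · minP
      descend {p} (acc smaller) p∈P = case p ≟P minP of λ where
        (yes p≡minP) → 0 , trans p≡minP (sym (·-identityˡ minP))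
        (no p≢minP) →
          let (c , p-minP≡) = descend (smaller (μ-decreasing p∈P p≢minP)) (⊖minP∈P p∈P p≢minP) in
          suc c , (begin
            p                                ≡⟨ [p⊖q]⊕q≡p p minP ⟨
            (p ⊖ minP) ⊕ minP                ≡⟨ cong (_⊕ minP) p-minP≡ ⟩
            ((+ suc c) · minP) ⊕ minP        ≡⟨ ·-suc (suc c) minP ⟨
            (+ suc (suc c)) · minP           ∎)

    minP≢0 : minP ≢ origin
    minP≢0 = Positive⇒≢origin (P-positive minP∈P)

    step-down : ∀ {c} → (+ suc (suc c)) · minP ∈ P → (+ suc c) · minP ∈ P
    step-down {c} m∈P = subst (_∈ P) m-minP≡ (⊖minP∈P m∈P m≢minP)
      where
      m-minP≡ : ((+ suc (suc c)) · minP) ⊖ minP ≡ (+ suc c) · minP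
      m-minP≡ = trans (cong (_⊖ minP) (·-suc (suc c) minP)) ([p⊕q]⊖q≡p ((+ suc c) · minP) minP)
      m≢minP : (+ suc (suc c)) · minP ≢ minP
      m≢minP m≡minP = case ·-cancelʳ minP≢0 (+ suc (suc c)) (+ 1) (trans m≡minP (sym (·-identityˡ minP))) of λ ()

    downward-closed : ∀ {c d} → d ℕ.≤′ c → (+ suc c) · minP ∈ P → (+ suc d) · minP ∈ P
    downward-closed ℕ.≤′-refl m∈P = m∈P
    downward-closed {suc c} (ℕ.≤′-step d≤′c) m∈P = downward-closed d≤′c (step-down {c} m∈P)

    T : ℕ
    T = length P

    multiple∈P⇒< : ∀ {c} → (+ suc c) · minP ∈ P → c < T
    multiple∈P⇒< {c} m∈P = subst (_≤ T) (length-positiveMultiples minP (suc c))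
      (unique-⊆⇒length≤ (positiveMultiples-unique minP minP≢0 (suc c)) multiples⊆P)
      where
      multiples⊆P : positiveMultiples minP (suc c) ⊆ P
      multiples⊆P y∈ = let (d , d∈ , y≡) = ∈-map⁻ (λ d → (+ suc d) · minP) y∈ in
        subst (_∈ P) (sym y≡) (downward-closed (ℕ.≤⇒≤′ (ℕ.≤-pred (∈-upTo⁻ d∈))) m∈P)

    <⇒multiple∈P : ∀ {c} → c < T → (+ suc c) · minP ∈ P
    <⇒multiple∈P {c} c<T = case Any.any? (((+ suc c) · minP) ≟P_) P of λ where
        (yes m∈P) → m∈P
        (no m∉P) → ⊥-elim (ℕ.<⇒≱ c<T (subst (T ≤_) (length-positiveMultiples minP c)
                     (unique-⊆⇒length≤ P-unique (P⊆multiples m∉P))))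
      where
      P⊆multiples : (+ suc c) · minP ∉ P → P ⊆ positiveMultiples minP c
      P⊆multiples m∉P y∈P = let (d , y≡) = multiple-of-minP y∈P in case d ℕ.<? c of λ where
        (yes d<c) → subst (_∈ positiveMultiples minP c) (sym y≡) (∈-map⁺ (λ d → (+ suc d) · minP) (∈-upTo⁺ d<c))
        (no d≮c) → ⊥-elim (m∉P (downward-closed (ℕ.≤⇒≤′ (ℕ.≮⇒≥ d≮c)) (subst (_∈ P) y≡ y∈P)))

  extremal⇒progression : ∃ λ p → ∃ λ T → IsProgression S p T
  extremal⇒progression = minP , T , record
    { step≢origin = minP≢0
    ; ⊆progression = ⊆progression
    ; progression⊆ = progression⊆
    }
    where
    ⊆progression : ∀ {x} → x ∈ S → BoundedMultiple T minP x
    ⊆progression x∈S = case ∈-±⁻ (⊆±positivePart x∈S) of λ where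
      (inj₁ x∈P) → let (c , x≡) = multiple-of-minP x∈P in
        + suc c , (λ ()) , multiple∈P⇒< (subst (_∈ P) x≡ x∈P) , x≡
      (inj₂ -x∈P) → let (c , -x≡) = multiple-of-minP -x∈P in
        -[1+ c ] , (λ ()) , multiple∈P⇒< (subst (_∈ P) -x≡ -x∈P) ,
        trans (sym (neg-involutive _)) (trans (cong neg -x≡) (neg-· (+ suc c) minP))
    progression⊆ : ∀ {x} → BoundedMultiple T minP x → x ∈ S
    progression⊆ (+ zero , c≢0 , _) = ⊥-elim (c≢0 refl)
    progression⊆ (+ suc c , _ , c<T , refl) = P⊆S (<⇒multiple∈P c<T)
    progression⊆ (-[1+ c ] , _ , c<T , refl) = subst (_∈ S) (neg-· (+ suc c) minP) (S-neg (P⊆S (<⇒multiple∈P c<T)))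

empty-progression : ∀ {s} → s ≢ origin → IsProgression [] s 0
empty-progression s≢0 = record
  { step≢origin = s≢0
  ; ⊆progression = λ ()
  ; progression⊆ = λ (c , c≢0 , c≤0 , _) → ⊥-elim (c≢0 (ℤ.∣i∣≡0⇒i≡0 (ℕ.n≤0⇒n≡0 c≤0)))
  }

theorem17 : ∀ (k m : ℕ) → 2 ≤ k → 1 ≤ m → (D : Fin m → Point) → IsDD D →
    (coverage k D ≡ k * (m * (m ∸ 1))) ⇔ EquivPerfectGolomb D
-- A single point has no differences: its difference list is the empty progression, with any step.
theorem17 k (suc zero) _ _ D dd =
  mk⇔ (λ _ → progression⇒perfectGolomb D dd single-point) (λ _ → progression⇒coverage D dd single-point k)
  where
  single-point : IsProgression (differences D) (+ 1 , 0ℤ) 0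
  single-point = empty-progression (λ ())
theorem17 k (suc (suc n)) k≥2 _ D dd = mk⇔
  (λ cov → let (_ , _ , progression) = extremal⇒progression k≥2 (differences-unique D dd) (differences-≢origin D dd)
                                          (differences-neg D) (extremal cov) (∈-differences⁺ D 0≢1) in
           progression⇒perfectGolomb D dd progression)
  (λ (_ , M , _ , perfect , r , s , D≈M) →
     progression⇒coverage D dd (perfectGolomb⇒progression D dd {M = M} perfect {r} {s} D≈M 0≢1) k)
  where
  0≢1 : Fin.zero ≢ Fin.suc Fin.zero
  0≢1 ()

  extremal : coverage k D ≡ k * (suc (suc n) * suc n) → length (nonzeroSums k (differences D)) ≡ k * length (differences D)
  extremal cov = trans (sym (coverage≡length-nonzeroSums D k)) (trans cov (cong (k *_) (sym (length-differences D))))
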